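{- Let $\mathcal{CS}$ be any constant specification. For every formula $A$ of the language of $\mathsf{LP}^{\mathsf{C}}_h$, if $\mathsf{LP}^{\mathsf{C}}_h(\mathcal{CS})\vdash A$, then $\mathsf{S4}^{\mathsf{C}}_h\vdash A^\circ$.
   Context: Fix a number $h\ge 1$ of agents. Throughout, $i$ ranges over $\{1,\dots,h\}$, $*$ over $\{1,\dots,h,\mathsf{C}\}$, and $\circledast$ over $\{1,\dots,h,\mathsf{E},\mathsf{C}\}$. For each $\circledast$ let $\mathrm{Cons}_\circledast$ (proof constants) and $\mathrm{Var}_\circledast$ (proof variables) be countably infinite sets, all pairwise disjoint. Evidence terms $\mathrm{Tm}_1,\dots,\mathrm{Tm}_h,\mathrm{Tm}_{\mathsf{E}},\mathrm{Tm}_{\mathsf{C}}$ are defined by simultaneous induction: $\mathrm{Cons}_\circledast\cup\mathrm{Var}_\circledast\subseteq\mathrm{Tm}_\circledast$; if $t\in\mathrm{Tm}_i$ then $!_i t\in\mathrm{Tm}_i$; if $t,s\in\mathrm{Tm}_*$ then $t+_*s,\ t\cdot_* s\in\mathrm{Tm}_*$; if $t_1\in\mathrm{Tm}_1,\dots,t_h\in\mathrm{Tm}_h$ then $\langle t_1,\dots,t_h\rangle\in\mathrm{Tm}_{\mathsf{E}}$; if $t\in\mathrm{Tm}_{\mathsf{E}}$ then $\pi_i t\in\mathrm{Tm}_i$; if $t\in\mathrm{Tm}_{\mathsf{C}}$ then $\mathsf{hd}(t),\mathsf{tl}(t)\in\mathrm{Tm}_{\mathsf{E}}$; if $t\in\mathrm{Tm}_{\mathsf{C}}$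 and $s\in\mathrm{Tm}_{\mathsf{E}}$ then $\mathsf{ind}(t,s)\in\mathrm{Tm}_{\mathsf{C}}$. Formulae are built from a countable set $\mathrm{Prop}$ of propositional variables using $\neg,\wedge,\vee,\to$ and the rule: if $A$ is a formula and $t\in\mathrm{Tm}_\circledast$ then $t{:}_\circledast A$ is a formula. Axioms of $\mathsf{LP}^{\mathsf{C}}_h$ (all instances): (1) propositional tautologies; (2) $t{:}_*(A\to B)\to(s{:}_*A\to (t\cdot s){:}_*B)$; (3) $t{:}_*A\to(t+s){:}_*A$ and $s{:}_*A\to(t+s){:}_*A$; (4) $t{:}_iA\to A$; (5) $t{:}_iA\to (!t){:}_i\, t{:}_iA$; (6) $t_1{:}_1A\wedge\dots\wedge t_h{:}_hA\to\langle t_1,\dots,t_h\rangle{:}_{\mathsf{E}}A$; (7) $t{:}_{\mathsf{E}}A\to (\pi_it){:}_iA$; (8) $t{:}_{\mathsf{C}}A\to\mathsf{hd}(t){:}_{\mathsf{E}}A$ and $t{:}_{\mathsf{C}}A\to\mathsf{tl}(t){:}_{\mathsf{E}}\,t{:}_{\mathsf{C}}A$; (9) $A\wedge t{:}_{\mathsf{C}}(A\to s{:}_{\mathsf{E}}A)\to\mathsf{ind}(t,s){:}_{\mathsf{C}}A$. A constant specification $\mathcal{CS}$ is any set of formulae $c{:}_\circledast A$ with $c\in\mathrm{Cons}_\circledast$ and $A$ an axiom. $\mathsf{LP}^{\mathsf{C}}_h(\mathcal{CS})$ is the Hilbert system with these axioms, modus ponens, and axiom necessitation (derive $c{:}_\circledast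 A$ whenever $c{:}_\circledast A\in\mathcal{CS}$). Modal formulae are built from $\mathrm{Prop}$ with $\neg,\wedge,\vee,\to$ and unary modalities $\Box_1,\dots,\Box_h,\mathsf{E},\mathsf{C}$. $\mathsf{S4}^{\mathsf{C}}_h$ is the Hilbert system with: propositional tautologies; for each $i$ the $\mathsf{S4}$ axioms $\Box_i(A\to B)\to(\Box_iA\to\Box_iB)$, $\Box_iA\to A$, $\Box_iA\to\Box_i\Box_iA$; the axioms $\mathsf{C}(A\to B)\to(\mathsf{C}A\to\mathsf{C}B)$, $\mathsf{C}A\to A$, $\mathsf{E}A\leftrightarrow\Box_1A\wedge\dots\wedge\Box_hA$, $A\wedge\mathsf{C}(A\to\mathsf{E}A)\to\mathsf{C}A$, $\mathsf{C}A\to\mathsf{E}(A\wedge\mathsf{C}A)$; modus ponens; and necessitation rules (from $A$ infer $\Box_iA$, and from $A$ infer $\mathsf{C}A$). The forgetful projection ${}^\circ$: $P^\circ=P$; commutes with connectives; $(t{:}_iA)^\circ=\Box_iA^\circ$, $(t{:}_{\mathsf{E}}A)^\circ=\mathsf{E}A^\circ$, $(t{:}_{\mathsf{C}}A)^\circ=\mathsf{C}A^\circ$. -}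

module Defs where

open import Data.Nat using (ℕ; zero; suc)
open import Data.Fin using (Fin; zero; suc)
open import Data.Bool using (Bool; true; false; not; _∧_; _∨_)
open import Relation.Binary.PropositionalEquality using (_≡_)

-- Convention: the number of agents is h = suc n (this encodes h ≥ 1).
-- Propositional variables, proof constants and proof variables are indexed by ℕ;
-- constants/variables of different sorts are distinct constructors / tags, hence
-- the sets are countably infinite and pairwise disjoint.

_⇒ᵇ_ : Bool → Bool → Bool
a ⇒ᵇ b = not a ∨ b

module _ (n : ℕ) where

  data Idx : Set where
    ag  : Fin (suc n) → Idx
    iE  : Idx
    iC  : Idx

  data Star : Set where
    sag : Fin (suc n) → Star
    sC  : Star

  ⌊_⌋ : Star → Idx
  ⌊ sag i ⌋ = ag i
  ⌊ sC ⌋    = iC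

  data Tm : Idx → Set where
    cons  : (s : Idx) → ℕ → Tm s
    var   : (s : Idx) → ℕ → Tm s
    bang  : (i : Fin (suc n)) → Tm (ag i) → Tm (ag i)
    plus  : (x : Star) → Tm ⌊ x ⌋ → Tm ⌊ x ⌋ → Tm ⌊ x ⌋
    app   : (x : Star) → Tm ⌊ x ⌋ → Tm ⌊ x ⌋ → Tm ⌊ x ⌋
    tuple : ((i : Fin (suc n)) → Tm (ag i)) → Tm iE
    proj  : (i : Fin (suc n)) → Tm iE → Tm (ag i)
    hd    : Tm iC → Tm iE
    tl    : Tm iC → Tm iE
    ind   : Tm iC → Tm iE → Tm iC

  data Fm : Set where
    prop : ℕ → Fm
    neg  : Fm → Fm
    and  : Fm → Fm → Fm
    or   : Fm → Fm → Fm
    imp  : Fm → Fm → Fm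
    jst  : (s : Idx) → Tm s → Fm → Fm

  ⋀ : ∀ {m} → (Fin (suc m) → Fm) → Fm
  ⋀ {zero}  f = f zero
  ⋀ {suc m} f = and (f zero) (⋀ (λ i → f (suc i)))

  iff : Fm → Fm → Fm
  iff A B = and (imp A B) (imp B A)

  evalF : (ℕ → Bool) → ((s : Idx) → Tm s → Fm → Bool) → Fm → Bool
  evalF v j (prop p)    = v p
  evalF v j (neg A)     = not (evalF v j A)
  evalF v j (and A B)   = evalF v j A ∧ evalF v j B
  evalF v j (or A B)    = evalF v j A ∨ evalF v j B
  evalF v j (imp A B)   = evalF v j A ⇒ᵇ evalF v j B
  evalF v j (jst s t A) = j s t A

  TautF : Fm → Set
  TautF A = ∀ v j → evalF v j A ≡ true

  data Ax : Fm → Set where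
    ax1  : ∀ {A} → TautF A → Ax A
    ax2  : ∀ (x : Star) (t s : Tm ⌊ x ⌋) A B →
           Ax (imp (jst ⌊ x ⌋ t (imp A B)) (imp (jst ⌊ x ⌋ s A) (jst ⌊ x ⌋ (app x t s) B)))
    ax3l : ∀ (x : Star) (t s : Tm ⌊ x ⌋) A →
           Ax (imp (jst ⌊ x ⌋ t A) (jst ⌊ x ⌋ (plus x t s) A))
    ax3r : ∀ (x : Star) (t s : Tm ⌊ x ⌋) A →
           Ax (imp (jst ⌊ x ⌋ s A) (jst ⌊ x ⌋ (plus x t s) A))
    ax4  : ∀ i (t : Tm (ag i)) A → Ax (imp (jst (ag i) t A) A)
    ax5  : ∀ i (t : Tm (ag i)) A →
           Ax (imp (jst (ag i) t A) (jst (ag i) (bang i t) (jst (ag i) t A)))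
    ax6  : ∀ (ts : (i : Fin (suc n)) → Tm (ag i)) A →
           Ax (imp (⋀ (λ i → jst (ag i) (ts i) A)) (jst iE (tuple ts) A))
    ax7  : ∀ i (t : Tm iE) A → Ax (imp (jst iE t A) (jst (ag i) (proj i t) A))
    ax8h : ∀ (t : Tm iC) A → Ax (imp (jst iC t A) (jst iE (hd t) A))
    ax8t : ∀ (t : Tm iC) A → Ax (imp (jst iC t A) (jst iE (tl t) (jst iC t A)))
    ax9  : ∀ (t : Tm iC) (s : Tm iE) A →
           Ax (imp (and A (jst iC t (imp A (jst iE s A)))) (jst iC (ind t s) A))

  -- a constant specification: a set of formulae c :_⊛ A with c ∈ Cons_⊛ and A an axiom;
  -- CS s c A  means  (cons s c) :_s A ∈ CS
  ConstSpec : Set₁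
  ConstSpec = Idx → ℕ → Fm → Set

  IsConstSpec : ConstSpec → Set
  IsConstSpec CS = ∀ s c A → CS s c A → Ax A

  data _⊢LP_ (CS : ConstSpec) : Fm → Set where
    axiom : ∀ {A} → Ax A → CS ⊢LP A
    mp    : ∀ {A B} → CS ⊢LP imp A B → CS ⊢LP A → CS ⊢LP B
    an    : ∀ {s c A} → CS s c A → CS ⊢LP jst s (cons s c) A

  data MFm : Set where
    mprop : ℕ → MFm
    mneg  : MFm → MFm
    mand  : MFm → MFm → MFm
    mor   : MFm → MFm → MFm
    mimp  : MFm → MFm → MFm
    box   : Fin (suc n) → MFm → MFm
    mE    : MFm → MFm
    mC    : MFm → MFm

  mff : MFm → MFm → MFm
  mff A B = mand (mimp A B) (mimp B A)

  ⋀m : ∀ {m} → (Fin (suc m) → MFm) → MFm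
  ⋀m {zero}  f = f zero
  ⋀m {suc m} f = mand (f zero) (⋀m (λ i → f (suc i)))

  data Mod : Set where
    mb : Fin (suc n) → Mod
    me : Mod
    mc : Mod

  evalM : (ℕ → Bool) → (Mod → MFm → Bool) → MFm → Bool
  evalM v j (mprop p)  = v p
  evalM v j (mneg A)   = not (evalM v j A)
  evalM v j (mand A B) = evalM v j A ∧ evalM v j B
  evalM v j (mor A B)  = evalM v j A ∨ evalM v j B
  evalM v j (mimp A B) = evalM v j A ⇒ᵇ evalM v j B
  evalM v j (box i A)  = j (mb i) A
  evalM v j (mE A)     = j me A
  evalM v j (mC A)     = j mc A

  TautM : MFm → Set
  TautM A = ∀ v j → evalM v j A ≡ true

  data ⊢S4C_ : MFm → Set where
    taut  : ∀ {A} → TautM A → ⊢S4C A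
    kB    : ∀ i A B → ⊢S4C mimp (box i (mimp A B)) (mimp (box i A) (box i B))
    tB    : ∀ i A → ⊢S4C mimp (box i A) A
    fourB : ∀ i A → ⊢S4C mimp (box i A) (box i (box i A))
    kC    : ∀ A B → ⊢S4C mimp (mC (mimp A B)) (mimp (mC A) (mC B))
    tC    : ∀ A → ⊢S4C mimp (mC A) A
    eAx   : ∀ A → ⊢S4C mff (mE A) (⋀m (λ i → box i A))
    indC  : ∀ A → ⊢S4C mimp (mand A (mC (mimp A (mE A)))) (mC A)
    fixC  : ∀ A → ⊢S4C mimp (mC A) (mE (mand A (mC A)))
    mpM   : ∀ {A B} → ⊢S4C mimp A B → ⊢S4C A → ⊢S4C B
    necB  : ∀ i {A} → ⊢S4C A → ⊢S4C box i A
    necC  : ∀ {A} → ⊢S4C A → ⊢S4C mC A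

  _° : Fm → MFm
  prop p °        = mprop p
  neg A °         = mneg (A °)
  and A B °       = mand (A °) (B °)
  or A B °        = mor (A °) (B °)
  imp A B °       = mimp (A °) (B °)
  jst (ag i) t A ° = box i (A °)
  jst iE t A °    = mE (A °)
  jst iC t A °    = mC (A °)

-- The forgetful projection commutes with the Boolean
-- connectives, so tautologies project to tautologies; each remaining axiom projects
-- to an S4ᶜ axiom or to an easy consequence of them (+ collapses to A → A, and the
-- E-axioms follow from E A ↔ □₁A ∧ … ∧ □ₕA). Axiom necessitation projects to
-- necessitation applied to a theorem, which is available for E as well as for □ᵢ
-- and C; this is where the hypothesis that CS only certifies axioms is used.
module Submission where

open import Data.Nat using (ℕ; zero; suc)
open import Data.Fin using (Fin; zero; suc)
open import Data.Bool using (Bool; true; false; not; _∧_; _∨_)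
open import Data.Bool.Properties using (∨-zeroʳ)
open import Relation.Binary.PropositionalEquality using (_≡_; refl; cong; cong₂; trans)
open import Defs

⇒ᵇ-refl : ∀ a → (a ⇒ᵇ a) ≡ true
⇒ᵇ-refl false = refl
⇒ᵇ-refl true  = refl

∧-⇒ᵇˡ : ∀ a b → ((a ∧ b) ⇒ᵇ a) ≡ true
∧-⇒ᵇˡ false b = refl
∧-⇒ᵇˡ true  b = ∨-zeroʳ (not b)

∧-⇒ᵇʳ : ∀ a b → ((a ∧ b) ⇒ᵇ b) ≡ true
∧-⇒ᵇʳ false b = refl
∧-⇒ᵇʳ true  b = ⇒ᵇ-refl b

⇒ᵇ-∧-intro : ∀ a b → (a ⇒ᵇ (b ⇒ᵇ (a ∧ b))) ≡ true
⇒ᵇ-∧-intro false b = refl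
⇒ᵇ-∧-intro true  b = ⇒ᵇ-refl b

⇒ᵇ-trans : ∀ a b c → ((a ⇒ᵇ b) ⇒ᵇ ((b ⇒ᵇ c) ⇒ᵇ (a ⇒ᵇ c))) ≡ true
⇒ᵇ-trans false b     c = ∨-zeroʳ (not (b ⇒ᵇ c))
⇒ᵇ-trans true  false c = refl
⇒ᵇ-trans true  true  c = ⇒ᵇ-refl c

∧-mono-⇒ᵇ : ∀ a b c d → ((a ⇒ᵇ c) ⇒ᵇ ((b ⇒ᵇ d) ⇒ᵇ ((a ∧ b) ⇒ᵇ (c ∧ d)))) ≡ true
∧-mono-⇒ᵇ false b c     d = ∨-zeroʳ (not (b ⇒ᵇ d))
∧-mono-⇒ᵇ true  b false d = refl
∧-mono-⇒ᵇ true  b true  d = ⇒ᵇ-refl (b ⇒ᵇ d)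

module _ (n : ℕ) where

  ⊢_ : MFm n → Set
  ⊢ X = ⊢S4C_ n X

  ⟦_⟧ : MFm n → (ℕ → Bool) → (Mod n → MFm n → Bool) → Bool
  ⟦ X ⟧ v j = evalM n v j X

  ⊢⇒-refl : ∀ X → ⊢ mimp X X
  ⊢⇒-refl X = taut λ v j → ⇒ᵇ-refl (⟦ X ⟧ v j)

  ⊢⇒-trans : ∀ {X Y Z} → ⊢ mimp X Y → ⊢ mimp Y Z → ⊢ mimp X Z
  ⊢⇒-trans {X} {Y} {Z} p q =
    mpM (mpM (taut λ v j → ⇒ᵇ-trans (⟦ X ⟧ v j) (⟦ Y ⟧ v j) (⟦ Z ⟧ v j)) p) q

  ⊢∧⇒ˡ : ∀ X Y → ⊢ mimp (mand X Y) X
  ⊢∧⇒ˡ X Y = taut λ v j → ∧-⇒ᵇˡ (⟦ X ⟧ v j) (⟦ Y ⟧ v j)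

  ⊢∧⇒ʳ : ∀ X Y → ⊢ mimp (mand X Y) Y
  ⊢∧⇒ʳ X Y = taut λ v j → ∧-⇒ᵇʳ (⟦ X ⟧ v j) (⟦ Y ⟧ v j)

  ⊢∧-intro : ∀ {X Y} → ⊢ X → ⊢ Y → ⊢ mand X Y
  ⊢∧-intro {X} {Y} p q =
    mpM (mpM (taut λ v j → ⇒ᵇ-∧-intro (⟦ X ⟧ v j) (⟦ Y ⟧ v j)) p) q

  ⊢∧-mono : ∀ {X Y Z W} → ⊢ mimp X Z → ⊢ mimp Y W → ⊢ mimp (mand X Y) (mand Z W)
  ⊢∧-mono {X} {Y} {Z} {W} p q = mpM (mpM (taut λ v j →
    ∧-mono-⇒ᵇ (⟦ X ⟧ v j) (⟦ Y ⟧ v j) (⟦ Z ⟧ v j) (⟦ W ⟧ v j)) p) q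

  ⊢⋀⇒ : ∀ {m} (f : Fin (suc m) → MFm n) i → ⊢ mimp (⋀m n f) (f i)
  ⊢⋀⇒ {zero}  f zero    = ⊢⇒-refl (f zero)
  ⊢⋀⇒ {suc m} f zero    = ⊢∧⇒ˡ _ _
  ⊢⋀⇒ {suc m} f (suc i) = ⊢⇒-trans (⊢∧⇒ʳ _ _) (⊢⋀⇒ (λ k → f (suc k)) i)

  ⊢⋀-mono : ∀ {m} {f g : Fin (suc m) → MFm n} →
            (∀ i → ⊢ mimp (f i) (g i)) → ⊢ mimp (⋀m n f) (⋀m n g)
  ⊢⋀-mono {zero}  p = p zero
  ⊢⋀-mono {suc m} p = ⊢∧-mono (p zero) (⊢⋀-mono (λ k → p (suc k)))

  ⊢⋀-intro : ∀ {m} {f : Fin (suc m) → MFm n} → (∀ i → ⊢ f i) → ⊢ ⋀m n f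
  ⊢⋀-intro {zero}  p = p zero
  ⊢⋀-intro {suc m} p = ⊢∧-intro (p zero) (⊢⋀-intro (λ k → p (suc k)))

  ⊢□-mono : ∀ i {X Y} → ⊢ mimp X Y → ⊢ mimp (box i X) (box i Y)
  ⊢□-mono i p = mpM (kB i _ _) (necB i p)

  ⊢E⇒⋀□ : ∀ X → ⊢ mimp (mE X) (⋀m n (λ i → box i X))
  ⊢E⇒⋀□ X = mpM (⊢∧⇒ˡ _ _) (eAx X)

  ⊢⋀□⇒E : ∀ X → ⊢ mimp (⋀m n (λ i → box i X)) (mE X)
  ⊢⋀□⇒E X = mpM (⊢∧⇒ʳ _ _) (eAx X)

  ⊢E-mono : ∀ {X Y} → ⊢ mimp X Y → ⊢ mimp (mE X) (mE Y)
  ⊢E-mono {X} {Y} p =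
    ⊢⇒-trans (⊢E⇒⋀□ X) (⊢⇒-trans (⊢⋀-mono (λ i → ⊢□-mono i p)) (⊢⋀□⇒E Y))

  ⊢E-nec : ∀ {X} → ⊢ X → ⊢ mE X
  ⊢E-nec {X} p = mpM (⊢⋀□⇒E X) (⊢⋀-intro (λ i → necB i p))

  modality : Idx n → Mod n
  modality (ag i) = mb i
  modality iE     = me
  modality iC     = mc

  eval-° : ∀ v j A → evalM n v j (_° n A) ≡ evalF n v (λ s _ B → j (modality s) (_° n B)) A
  eval-° v j (prop p)         = refl
  eval-° v j (neg A)          = cong not (eval-° v j A)
  eval-° v j (and A B)        = cong₂ _∧_ (eval-° v j A) (eval-° v j B)
  eval-° v j (or A B)         = cong₂ _∨_ (eval-° v j A) (eval-° v j B)
  eval-° v j (imp A B)        = cong₂ _⇒ᵇ_ (eval-° v j A) (eval-° v j B)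
  eval-° v j (jst (ag i) t A) = refl
  eval-° v j (jst iE t A)     = refl
  eval-° v j (jst iC t A)     = refl

  °-taut : ∀ A → TautF n A → TautM n (_° n A)
  °-taut A τ v j = trans (eval-° v j A) (τ v _)

  °-⋀ : ∀ {m} (f : Fin (suc m) → Fm n) → _° n (⋀ n f) ≡ ⋀m n (λ i → _° n (f i))
  °-⋀ {zero}  f = refl
  °-⋀ {suc m} f = cong (mand (_° n (f zero))) (°-⋀ (λ i → f (suc i)))

  Ax⇒⊢° : ∀ {A} → Ax n A → ⊢ _° n A
  Ax⇒⊢° (ax1 {A} τ)            = taut (°-taut A τ)
  Ax⇒⊢° (ax2 (sag i) t s A B)  = kB i _ _
  Ax⇒⊢° (ax2 sC t s A B)       = kC _ _
  Ax⇒⊢° (ax3l (sag i) t s A)   = ⊢⇒-refl _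
  Ax⇒⊢° (ax3l sC t s A)        = ⊢⇒-refl _
  Ax⇒⊢° (ax3r (sag i) t s A)   = ⊢⇒-refl _
  Ax⇒⊢° (ax3r sC t s A)        = ⊢⇒-refl _
  Ax⇒⊢° (ax4 i t A)            = tB i _
  Ax⇒⊢° (ax5 i t A)            = fourB i _
  Ax⇒⊢° (ax6 ts A) rewrite °-⋀ (λ i → jst (ag i) (ts i) A) = ⊢⋀□⇒E (_° n A)
  Ax⇒⊢° (ax7 i t A)            = ⊢⇒-trans (⊢E⇒⋀□ _) (⊢⋀⇒ (λ k → box k (_° n A)) i)
  Ax⇒⊢° (ax8h t A)             = ⊢⇒-trans (fixC _) (⊢E-mono (⊢∧⇒ˡ _ _))
  Ax⇒⊢° (ax8t t A)             = ⊢⇒-trans (fixC _) (⊢E-mono (⊢∧⇒ʳ _ _))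
  Ax⇒⊢° (ax9 t s A)            = indC _

  ⊢LP⇒⊢S4C° : (CS : ConstSpec n) → IsConstSpec n CS → ∀ {A} → _⊢LP_ n CS A → ⊢ _° n A
  ⊢LP⇒⊢S4C° CS CS-ax (axiom ax) = Ax⇒⊢° ax
  ⊢LP⇒⊢S4C° CS CS-ax (mp p q)   = mpM (⊢LP⇒⊢S4C° CS CS-ax p) (⊢LP⇒⊢S4C° CS CS-ax q)
  ⊢LP⇒⊢S4C° CS CS-ax (an {ag i} {c} {A} c∈CS) = necB i (Ax⇒⊢° (CS-ax _ c A c∈CS))
  ⊢LP⇒⊢S4C° CS CS-ax (an {iE}   {c} {A} c∈CS) = ⊢E-nec (Ax⇒⊢° (CS-ax _ c A c∈CS))
  ⊢LP⇒⊢S4C° CS CS-ax (an {iC}   {c} {A} c∈CS) = necC (Ax⇒⊢° (CS-ax _ c A c∈CS))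

lemma11 : (n : ℕ) (CS : ConstSpec n) → IsConstSpec n CS →
          (A : Fm n) → _⊢LP_ n CS A → ⊢S4C_ n (_° n A)
lemma11 n CS CS-ax A = ⊢LP⇒⊢S4C° n CS CS-ax
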